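{- For $n\ge3$ and $k\ge1$, $$Q_{n+k-1,132}^{(k,0,\emptyset,0)}(x)|_{x^{n-2}}=2(k-1)+\binom{n}{2}.$$
   Context: For $\sigma=\sigma_1\cdots\sigma_m\in S_m$, $\mathrm{mmp}^{(k,0,\emptyset,0)}(\sigma)$ is the number of positions $i$ such that there are at least $k$ indices $j>i$ with $\sigma_j>\sigma_i$ and no $j<i$ with $\sigma_j<\sigma_i$. $S_m(132)$ is the set of 132-avoiding permutations of $[m]$. $Q_{m,132}^{(k,0,\emptyset,0)}(x)=\sum_{\sigma\in S_m(132)}x^{\mathrm{mmp}^{(k,0,\emptyset,0)}(\sigma)}$. $P(x)|_{x^r}$ is the coefficient of $x^r$. -}

module Defs where

open import Data.Nat using (ℕ; zero; suc; _+_; _<ᵇ_; _≡ᵇ_; _≤ᵇ_)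
open import Data.Bool using (Bool; true; false; _∧_; not; if_then_else_)
open import Data.List using (List; []; _∷_; map; concatMap; length; filter; upTo)
open import Data.Bool.ListAction using (any)
import Data.Bool.Properties

-- Permutations of [m] = {1,...,m}, written as words σ₁⋯σₘ (lists of naturals).
-- Every permutation of [m] appears exactly once in perms m
-- (obtained by inserting m into every position of each permutation of [m-1]).
insertAll : ℕ → List ℕ → List (List ℕ)
insertAll x [] = (x ∷ []) ∷ []
insertAll x (y ∷ ys) = (x ∷ y ∷ ys) ∷ map (y ∷_) (insertAll x ys)

perms : ℕ → List (List ℕ)
perms zero = [] ∷ []
perms (suc m) = concatMap (insertAll (suc m)) (perms m)

-- entry at 0-based position i (0 outside range; never used there)
at : List ℕ → ℕ → ℕ
at [] _ = 0
at (x ∷ xs) zero = x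
at (x ∷ xs) (suc i) = at xs i

countB : {A : Set} → (A → Bool) → List A → ℕ
countB p [] = 0
countB p (x ∷ xs) = if p x then suc (countB p xs) else countB p xs

contains132 : List ℕ → Bool
contains132 σ =
  any (λ i → any (λ j → any (λ l →
        (i <ᵇ j) ∧ (j <ᵇ l) ∧ (at σ i <ᵇ at σ l) ∧ (at σ l <ᵇ at σ j))
      (upTo (length σ))) (upTo (length σ))) (upTo (length σ))

perms132 : ℕ → List (List ℕ)
perms132 m = Data.List.filter (λ σ → Data.Bool.Properties.T? (not (contains132 σ))) (perms m)

-- mmp^(k,0,∅,0)(σ): number of positions i such that at least k positions j > i
-- have σ_j > σ_i, and no position j < i has σ_j < σ_i.
mmp : ℕ → List ℕ → ℕ
mmp k σ = countB isPt (upTo (length σ))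
  where
  isPt : ℕ → Bool
  isPt i = (k ≤ᵇ countB (λ j → (i <ᵇ j) ∧ (at σ i <ᵇ at σ j)) (upTo (length σ)))
         ∧ not (any (λ j → (j <ᵇ i) ∧ (at σ j <ᵇ at σ i)) (upTo (length σ)))

-- Q_{m,132}^{(k,0,∅,0)}(x) |_{x^r} = #{σ ∈ S_m(132) : mmp(σ) = r}
coeffQ132 : (m k r : ℕ) → ℕ
coeffQ132 m k r = countB (λ σ → mmp k σ ≡ᵇ r) (perms132 m)

module Submission where

-- Write N k m r for #{σ ∈ S_m(132) : mmp_k σ = r} (an mmp_k point is a
-- left-to-right minimum with at least k larger entries to its right).
--  * Decomposition.  A permutation of [m+1] avoids 132 iff it has the form
--    α' (m+1) β where β ∈ S_b(132), α' is some α ∈ S_p(132) shifted up by b,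
--    and p + b = m (every entry before the maximum exceeds every entry after).
--  * The statistic splits: mmp_{k+1}(α' (m+1) β) = mmp_k α + mmp_{k+1} β, and
--    mmp_0(α' (m+1) β) is mmp_0 α + mmp_0 β, or 1 + mmp_0 β when α is empty.
--  * mmp_k σ ≤ |σ| - k, so in the resulting convolution sums every split whose
--    bounds add up to less than r vanishes, and a split whose bounds add up to
--    exactly r contributes a product of two "extremal" counts.
--  * Extremal counts: N 0 m m = 1, N 0 (m+1) m = C(m+1,2) and N k m (m-k) = 1
--    for k < m.  The theorem then follows by induction on k: raising k by one
--    keeps the previous count and adds exactly two new permutations.

open import Defs
open import Data.Nat using (ℕ; zero; suc; _+_; _*_; _∸_; _≤_; _<_; z≤n; s≤s; _<ᵇ_; _≡ᵇ_; _≤ᵇ_)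
open import Data.Nat.Properties
open import Data.Nat.Combinatorics using (_C_; nC1≡n; nCk+nC[k+1]≡[n+1]C[k+1])
open import Data.Bool using (Bool; true; false; _∧_; _∨_; not; if_then_else_; T)
open import Data.Bool.ListAction using (any)
import Data.Bool.Properties as BP
open import Data.List using (List; []; _∷_; map; concatMap; length; filter; applyUpTo; _++_; take; drop)
import Data.List.Properties as LP
open import Data.List.Relation.Unary.All using (All; []; _∷_)
import Data.List.Relation.Unary.All as All
import Data.List.Relation.Unary.All.Properties as AllP
open import Data.Product using (_×_; _,_; proj₁; proj₂)
open import Data.Sum using (inj₁; inj₂)
open import Function using (_∘_)
open import Relation.Binary.PropositionalEquality
open import Relation.Nullary.Decidable using (T?; dec-true; dec-false)
open import Algebra.Properties.CommutativeSemigroup +-commutativeSemigroup using (interchange)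

infixr 7 _⊙_
_⊙_ : Bool → ℕ → ℕ
true  ⊙ n = n
false ⊙ n = 0

sumL : {A : Set} → (A → ℕ) → List A → ℕ
sumL f []       = 0
sumL f (x ∷ xs) = f x + sumL f xs

countB-as-sum : {A : Set} (p : A → Bool) (L : List A) → countB p L ≡ sumL (λ x → p x ⊙ 1) L
countB-as-sum p [] = refl
countB-as-sum p (x ∷ xs) with p x
... | true  = cong suc (countB-as-sum p xs)
... | false = countB-as-sum p xs

sumL-cong : {A : Set} {f g : A → ℕ} (L : List A) → (∀ x → f x ≡ g x) → sumL f L ≡ sumL g L
sumL-cong []       e = refl
sumL-cong (x ∷ xs) e = cong₂ _+_ (e x) (sumL-cong xs e)

sumL-congAll : {A : Set} {f g : A → ℕ} {L : List A} → All (λ x → f x ≡ g x) L → sumL f L ≡ sumL g L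
sumL-congAll []       = refl
sumL-congAll (e ∷ es) = cong₂ _+_ e (sumL-congAll es)

sumL-zero : {A : Set} (L : List A) → sumL (λ _ → 0) L ≡ 0
sumL-zero []      = refl
sumL-zero (_ ∷ L) = sumL-zero L

sumL-++ : {A : Set} (f : A → ℕ) (xs ys : List A) → sumL f (xs ++ ys) ≡ sumL f xs + sumL f ys
sumL-++ f []       ys = refl
sumL-++ f (x ∷ xs) ys = trans (cong (f x +_) (sumL-++ f xs ys)) (sym (+-assoc (f x) _ _))

sumL-concatMap : {A B : Set} (f : B → ℕ) (g : A → List B) (L : List A) →
  sumL f (concatMap g L) ≡ sumL (λ x → sumL f (g x)) L
sumL-concatMap f g []       = refl
sumL-concatMap f g (x ∷ xs) =
  trans (sumL-++ f (g x) (concatMap g xs)) (cong (sumL f (g x) +_) (sumL-concatMap f g xs))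

sumL-map : {A B : Set} (f : B → ℕ) (g : A → B) (L : List A) → sumL f (map g L) ≡ sumL (f ∘ g) L
sumL-map f g []       = refl
sumL-map f g (x ∷ xs) = cong (f (g x) +_) (sumL-map f g xs)

sumL-+ : {A : Set} (f g : A → ℕ) (L : List A) → sumL (λ x → f x + g x) L ≡ sumL f L + sumL g L
sumL-+ f g []       = refl
sumL-+ f g (x ∷ xs) = trans (cong (f x + g x +_) (sumL-+ f g xs)) (interchange (f x) (g x) _ _)

⊙-+ : ∀ b m n → b ⊙ (m + n) ≡ b ⊙ m + b ⊙ n
⊙-+ true  m n = refl
⊙-+ false m n = refl

sumL-⊙ : {A : Set} (b : Bool) (f : A → ℕ) (L : List A) → sumL (λ x → b ⊙ f x) L ≡ b ⊙ sumL f L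
sumL-⊙ true  f L = refl
sumL-⊙ false f L = sumL-zero L

sumL-swap : {A B : Set} (h : A → B → ℕ) (L1 : List A) (L2 : List B) →
  sumL (λ x → sumL (h x) L2) L1 ≡ sumL (λ y → sumL (λ x → h x y) L1) L2
sumL-swap h []       L2 = sym (sumL-zero L2)
sumL-swap h (x ∷ xs) L2 =
  trans (cong (sumL (h x) L2 +_) (sumL-swap h xs L2)) (sym (sumL-+ (h x) (λ y → sumL (λ x' → h x' y) xs) L2))

sumL-* : {A B : Set} (f : A → ℕ) (g : B → ℕ) (L1 : List A) (L2 : List B) →
  sumL (λ x → sumL (λ y → f x * g y) L2) L1 ≡ sumL f L1 * sumL g L2
sumL-* f g []       L2 = refl
sumL-* f g (x ∷ xs) L2 =
  trans (cong₂ _+_ (scale (f x) L2) (sumL-* f g xs L2)) (sym (*-distribʳ-+ (sumL g L2) (f x) (sumL f xs)))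
  where
  scale : ∀ c L → sumL (λ y → c * g y) L ≡ c * sumL g L
  scale c []       = sym (*-zeroʳ c)
  scale c (y ∷ ys) = trans (cong (c * g y +_) (scale c ys)) (sym (*-distribˡ-+ c (g y) (sumL g ys)))

sumL-filter : {A : Set} (p : A → Bool) (f : A → ℕ) (L : List A) →
  sumL f (filter (λ x → T? (p x)) L) ≡ sumL (λ x → p x ⊙ f x) L
sumL-filter p f [] = refl
sumL-filter p f (x ∷ xs) with p x
... | true  = cong (f x +_) (sumL-filter p f xs)
... | false = sumL-filter p f xs

Σr : ℕ → (ℕ → ℕ) → ℕ
Σr zero    h = 0
Σr (suc n) h = h 0 + Σr n (h ∘ suc)

Σr-cong : ∀ n {h h' : ℕ → ℕ} → (∀ i → i < n → h i ≡ h' i) → Σr n h ≡ Σr n h'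
Σr-cong zero    e = refl
Σr-cong (suc n) e = cong₂ _+_ (e 0 (s≤s z≤n)) (Σr-cong n (λ i p → e (suc i) (s≤s p)))

sumL-applyUpTo : {A : Set} (H : A → ℕ) (f : ℕ → A) (n : ℕ) → sumL H (applyUpTo f n) ≡ Σr n (H ∘ f)
sumL-applyUpTo H f zero    = refl
sumL-applyUpTo H f (suc n) = cong (H (f 0) +_) (sumL-applyUpTo H (f ∘ suc) n)

Σr-+ : ∀ n (f g : ℕ → ℕ) → Σr n (λ i → f i + g i) ≡ Σr n f + Σr n g
Σr-+ zero    f g = refl
Σr-+ (suc n) f g = trans (cong (f 0 + g 0 +_) (Σr-+ n (f ∘ suc) (g ∘ suc))) (interchange (f 0) (g 0) _ _)

Σr-zero : ∀ n → Σr n (λ _ → 0) ≡ 0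
Σr-zero zero    = refl
Σr-zero (suc n) = Σr-zero n

sumL-Σr : {A : Set} (n : ℕ) (h : A → ℕ → ℕ) (L : List A) →
  sumL (λ x → Σr n (h x)) L ≡ Σr n (λ i → sumL (λ x → h x i) L)
sumL-Σr n h []       = sym (Σr-zero n)
sumL-Σr n h (x ∷ xs) =
  trans (cong (Σr n (h x) +_) (sumL-Σr n h xs)) (sym (Σr-+ n (h x) (λ i → sumL (λ x' → h x' i) xs)))

-- Σ_{p + b = m} F p b: the convolution sums produced by the decomposition.
Σ₂ : ℕ → (ℕ → ℕ → ℕ) → ℕ
Σ₂ zero    F = F 0 0
Σ₂ (suc m) F = F 0 (suc m) + Σ₂ m (λ p b → F (suc p) b)

Σr-as-Σ₂ : ∀ m (F : ℕ → ℕ → ℕ) → Σr (suc m) (λ p → F p (m ∸ p)) ≡ Σ₂ m F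
Σr-as-Σ₂ zero    F = +-identityʳ (F 0 0)
Σr-as-Σ₂ (suc m) F = cong (F 0 (suc m) +_) (Σr-as-Σ₂ m (λ p b → F (suc p) b))

Σ₂-cong : ∀ m {F G : ℕ → ℕ → ℕ} → (∀ p b → p + b ≡ m → F p b ≡ G p b) → Σ₂ m F ≡ Σ₂ m G
Σ₂-cong zero    e = e 0 0 refl
Σ₂-cong (suc m) e = cong₂ _+_ (e 0 (suc m) refl) (Σ₂-cong m (λ p b q → e (suc p) b (cong suc q)))

Σ₂-last : ∀ m (F : ℕ → ℕ → ℕ) → Σ₂ (suc m) F ≡ Σ₂ m (λ p b → F p (suc b)) + F (suc m) 0
Σ₂-last zero    F = refl
Σ₂-last (suc m) F =
  trans (cong (F 0 (suc (suc m)) +_) (Σ₂-last m (λ p b → F (suc p) b))) (sym (+-assoc (F 0 (suc (suc m))) _ _))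

Σ₂-vanish : ∀ m {F : ℕ → ℕ → ℕ} → (∀ p b → p + b ≡ m → F p b ≡ 0) → Σ₂ m F ≡ 0
Σ₂-vanish m e = trans (Σ₂-cong m e) (zeros m)
  where
  zeros : ∀ m → Σ₂ m (λ _ _ → 0) ≡ 0
  zeros zero    = refl
  zeros (suc m) = zeros m

Σ₂-ones : ∀ m {F : ℕ → ℕ → ℕ} → (∀ p b → p + b ≡ m → F p b ≡ 1) → Σ₂ m F ≡ suc m
Σ₂-ones m e = trans (Σ₂-cong m e) (ones m)
  where
  ones : ∀ m → Σ₂ m (λ _ _ → 1) ≡ suc m
  ones zero    = refl
  ones (suc m) = cong suc (ones m)

-- The bounded quantifiers below let these index-based definitions be
-- rewritten as structural recursion on the permutation word.
anyR : ℕ → (ℕ → Bool) → Bool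
anyR zero    h = false
anyR (suc n) h = h 0 ∨ anyR n (h ∘ suc)

countR : ℕ → (ℕ → Bool) → ℕ
countR zero    h = 0
countR (suc n) h = if h 0 then suc (countR n (h ∘ suc)) else countR n (h ∘ suc)

anyR-cong : ∀ n {h h' : ℕ → Bool} → (∀ i → h i ≡ h' i) → anyR n h ≡ anyR n h'
anyR-cong zero    e = refl
anyR-cong (suc n) e = cong₂ _∨_ (e 0) (anyR-cong n (e ∘ suc))

countR-cong : ∀ n {h h' : ℕ → Bool} → (∀ i → h i ≡ h' i) → countR n h ≡ countR n h'
countR-cong zero    e = refl
countR-cong (suc n) e = cong₂ (λ b c → if b then suc c else c) (e 0) (countR-cong n (e ∘ suc))

anyR-false : ∀ n → anyR n (λ _ → false) ≡ false
anyR-false zero    = refl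
anyR-false (suc n) = anyR-false n

any-applyUpTo : (g : ℕ → Bool) (f : ℕ → ℕ) (n : ℕ) → any g (applyUpTo f n) ≡ anyR n (g ∘ f)
any-applyUpTo g f zero    = refl
any-applyUpTo g f (suc n) = cong (g (f 0) ∨_) (any-applyUpTo g (f ∘ suc) n)

countB-applyUpTo : (g : ℕ → Bool) (f : ℕ → ℕ) (n : ℕ) → countB g (applyUpTo f n) ≡ countR n (g ∘ f)
countB-applyUpTo g f zero    = refl
countB-applyUpTo g f (suc n) = cong (λ c → if g (f 0) then suc c else c) (countB-applyUpTo g (f ∘ suc) n)

applyUpTo-at : (xs : List ℕ) → applyUpTo (at xs) (length xs) ≡ xs
applyUpTo-at []       = refl
applyUpTo-at (x ∷ xs) = cong (x ∷_) (applyUpTo-at xs)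

any-at : (g : ℕ → Bool) (xs : List ℕ) → anyR (length xs) (g ∘ at xs) ≡ any g xs
any-at g xs = trans (sym (any-applyUpTo g (at xs) (length xs))) (cong (any g) (applyUpTo-at xs))

countR-at : (g : ℕ → Bool) (xs : List ℕ) → countR (length xs) (g ∘ at xs) ≡ countB g xs
countR-at g xs = trans (sym (countB-applyUpTo g (at xs) (length xs))) (cong (countB g) (applyUpTo-at xs))

-- leads132 x ys: x is the "1" of a 132 whose "3" and "2" lie in ys.
leads132 : ℕ → List ℕ → Bool
leads132 x []       = false
leads132 x (y ∷ ys) = any (λ z → (x <ᵇ z) ∧ (z <ᵇ y)) ys ∨ leads132 x ys

has132 : List ℕ → Bool
has132 []       = false
has132 (x ∷ xs) = leads132 x xs ∨ has132 xs

has132ᵢ : List ℕ → Bool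
has132ᵢ xs = anyR (length xs) (λ i → anyR (length xs) (λ j → anyR (length xs) (λ l →
  (i <ᵇ j) ∧ (j <ᵇ l) ∧ (at xs i <ᵇ at xs l) ∧ (at xs l <ᵇ at xs j))))

leads132ᵢ : ℕ → List ℕ → Bool
leads132ᵢ x xs = anyR (length xs) (λ j → anyR (length xs) (λ l →
  (j <ᵇ l) ∧ (x <ᵇ at xs l) ∧ (at xs l <ᵇ at xs j)))

leads132ᵢ≡leads132 : ∀ x xs → leads132ᵢ x xs ≡ leads132 x xs
leads132ᵢ≡leads132 x []       = refl
leads132ᵢ≡leads132 x (y ∷ ys) =
  cong₂ _∨_ (any-at (λ z → (x <ᵇ z) ∧ (z <ᵇ y)) ys) (leads132ᵢ≡leads132 x ys)

-- Peeling off position 0: triples starting there give leads132 (triples with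
-- j = 0 are impossible), the remaining triples are those of the tail.
has132ᵢ≡has132 : ∀ xs → has132ᵢ xs ≡ has132 xs
has132ᵢ≡has132 []       = refl
has132ᵢ≡has132 (x ∷ xs) = cong₂ _∨_ first (trans (anyR-cong n rest) (has132ᵢ≡has132 xs))
  where
  n = length xs
  xs' = x ∷ xs
  first : anyR (suc n) (λ j → anyR (suc n) (λ l →
            (0 <ᵇ j) ∧ (j <ᵇ l) ∧ (x <ᵇ at xs' l) ∧ (at xs' l <ᵇ at xs' j)))
          ≡ leads132 x xs
  first = trans (cong (_∨ leads132ᵢ x xs) (anyR-false (suc n))) (leads132ᵢ≡leads132 x xs)
  rest : ∀ i → anyR (suc n) (λ j → anyR (suc n) (λ l →
                 (suc i <ᵇ j) ∧ (j <ᵇ l) ∧ (at xs i <ᵇ at xs' l) ∧ (at xs' l <ᵇ at xs' j)))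
             ≡ anyR n (λ j → anyR n (λ l →
                 (i <ᵇ j) ∧ (j <ᵇ l) ∧ (at xs i <ᵇ at xs l) ∧ (at xs l <ᵇ at xs j)))
  rest i = trans (cong (_∨ anyR n (λ j → anyR (suc n) (λ l →
                   (i <ᵇ j) ∧ (suc j <ᵇ l) ∧ (at xs i <ᵇ at xs' l) ∧ (at xs' l <ᵇ at xs j))))
                   (anyR-false (suc n)))
             (anyR-cong n (λ j → cong (_∨ anyR n (λ l →
                   (i <ᵇ j) ∧ (j <ᵇ l) ∧ (at xs i <ᵇ at xs l) ∧ (at xs l <ᵇ at xs j)))
                 (BP.∧-zeroʳ (i <ᵇ j))))

contains132≡has132 : ∀ σ → contains132 σ ≡ has132 σ
contains132≡has132 σ = trans index-form (has132ᵢ≡has132 σ)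
  where
  n = length σ
  index-form : contains132 σ ≡ has132ᵢ σ
  index-form = trans (any-applyUpTo _ (λ i → i) n) (anyR-cong n (λ i →
    trans (any-applyUpTo _ (λ i → i) n) (anyR-cong n (λ j → any-applyUpTo _ (λ i → i) n))))

-- mmpFrom k pre xs counts the mmp_k points among the entries of xs when xs is
-- preceded by the entries of pre: an entry counts if at least k later entries
-- exceed it and no earlier entry (in pre or xs) is smaller.
mmpFrom : ℕ → List ℕ → List ℕ → ℕ
mmpFrom k pre []       = 0
mmpFrom k pre (x ∷ xs) =
  ((k ≤ᵇ countB (x <ᵇ_) xs) ∧ not (any (_<ᵇ x) pre)) ⊙ 1 + mmpFrom k (x ∷ pre) xs

mmpFromᵢ : ℕ → List ℕ → List ℕ → ℕ
mmpFromᵢ k pre xs = countR (length xs) (λ i →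
    (k ≤ᵇ countR (length xs) (λ j → (i <ᵇ j) ∧ (at xs i <ᵇ at xs j)))
  ∧ not (any (_<ᵇ at xs i) pre ∨ anyR (length xs) (λ j → (j <ᵇ i) ∧ (at xs j <ᵇ at xs i))))

if-suc : ∀ b c → (if b then suc c else c) ≡ b ⊙ 1 + c
if-suc true  c = refl
if-suc false c = refl

∨-rot : ∀ p c r → p ∨ (c ∨ r) ≡ (c ∨ p) ∨ r
∨-rot p c r = trans (sym (BP.∨-assoc p c r)) (cong (_∨ r) (BP.∨-comm p c))

-- Peeling off position 0: its entry x is a point or not, and for the later
-- positions x joins the prefix.
mmpFromᵢ≡mmpFrom : ∀ k pre xs → mmpFromᵢ k pre xs ≡ mmpFrom k pre xs
mmpFromᵢ≡mmpFrom k pre []       = refl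
mmpFromᵢ≡mmpFrom k pre (x ∷ xs) =
  trans (cong₂ (λ b c → if b then suc c else c) head
               (trans (countR-cong n tail) (mmpFromᵢ≡mmpFrom k (x ∷ pre) xs)))
        (if-suc ((k ≤ᵇ countB (x <ᵇ_) xs) ∧ not (any (_<ᵇ x) pre)) (mmpFrom k (x ∷ pre) xs))
  where
  n = length xs
  head : (k ≤ᵇ countR n (λ j → x <ᵇ at xs j)) ∧ not (any (_<ᵇ x) pre ∨ anyR n (λ _ → false))
         ≡ (k ≤ᵇ countB (x <ᵇ_) xs) ∧ not (any (_<ᵇ x) pre)
  head = cong₂ (λ a b → (k ≤ᵇ a) ∧ not b) (countR-at (x <ᵇ_) xs)
           (trans (cong (any (_<ᵇ x) pre ∨_) (anyR-false n)) (BP.∨-identityʳ _))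
  tail : ∀ i →
    ((k ≤ᵇ countR n (λ j → (i <ᵇ j) ∧ (at xs i <ᵇ at xs j)))
      ∧ not (any (_<ᵇ at xs i) pre ∨ ((x <ᵇ at xs i) ∨ anyR n (λ j → (j <ᵇ i) ∧ (at xs j <ᵇ at xs i)))))
    ≡ ((k ≤ᵇ countR n (λ j → (i <ᵇ j) ∧ (at xs i <ᵇ at xs j)))
      ∧ not (any (_<ᵇ at xs i) (x ∷ pre) ∨ anyR n (λ j → (j <ᵇ i) ∧ (at xs j <ᵇ at xs i))))
  tail i = cong (λ b → (k ≤ᵇ countR n (λ j → (i <ᵇ j) ∧ (at xs i <ᵇ at xs j))) ∧ not b)
             (∨-rot (any (_<ᵇ at xs i) pre) (x <ᵇ at xs i) (anyR n (λ j → (j <ᵇ i) ∧ (at xs j <ᵇ at xs i))))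

mmpₛ : ℕ → List ℕ → ℕ
mmpₛ k = mmpFrom k []

mmp≡mmpₛ : ∀ k σ → mmp k σ ≡ mmpₛ k σ
mmp≡mmpₛ k σ = trans index-form (mmpFromᵢ≡mmpFrom k [] σ)
  where
  n = length σ
  index-form : mmp k σ ≡ mmpFromᵢ k [] σ
  index-form = trans (countB-applyUpTo _ (λ i → i) n) (countR-cong n (λ i →
    cong₂ (λ a b → (k ≤ᵇ a) ∧ not b) (countB-applyUpTo _ (λ i → i) n) (any-applyUpTo _ (λ i → i) n)))

Shape : ℕ → List ℕ → Set
Shape m σ = (length σ ≡ m) × All (λ x → 1 ≤ x × x ≤ m) σ

insertAll-length : ∀ x τ → All (λ σ → length σ ≡ suc (length τ)) (insertAll x τ)
insertAll-length x []       = refl ∷ []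
insertAll-length x (y ∷ ys) = refl ∷ AllP.map⁺ (All.map (cong suc) (insertAll-length x ys))

insertAll-All : ∀ {P : ℕ → Set} x τ → P x → All P τ → All (All P) (insertAll x τ)
insertAll-All x []       px []         = (px ∷ []) ∷ []
insertAll-All x (y ∷ ys) px (py ∷ pys) =
  (px ∷ py ∷ pys) ∷ AllP.map⁺ (All.map (py ∷_) (insertAll-All x ys px pys))

perms-shape : ∀ m → All (Shape m) (perms m)
perms-shape zero    = (refl , []) ∷ []
perms-shape (suc m) = AllP.concat⁺ (AllP.map⁺ (All.map insert (perms-shape m)))
  where
  insert : ∀ {τ} → Shape m τ → All (Shape (suc m)) (insertAll (suc m) τ)
  insert {τ} (len , bnd) = All.zipWith (λ { (l , a) → trans l (cong suc len) , a })
    (insertAll-length (suc m) τ ,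
     insertAll-All (suc m) τ (s≤s z≤n , ≤-refl) (All.map (λ { (a , b) → a , m≤n⇒m≤1+n b }) bnd))

perms132-shape : ∀ m → All (Shape m) (perms132 m)
perms132-shape m = AllP.filter⁺ (λ σ → T? (not (contains132 σ))) (perms-shape m)

<ᵇ-false : ∀ {a b} → b ≤ a → (a <ᵇ b) ≡ false
<ᵇ-false z≤n     = refl
<ᵇ-false (s≤s p) = <ᵇ-false p

<ᵇ-true : ∀ {a b} → a < b → (a <ᵇ b) ≡ true
<ᵇ-true (s≤s z≤n)     = refl
<ᵇ-true (s≤s (s≤s p)) = <ᵇ-true (s≤s p)

any-false : {A : Set} (g : A → Bool) (L : List A) → All (λ z → g z ≡ false) L → any g L ≡ false
any-false g []       []       = refl
any-false g (x ∷ xs) (e ∷ es) = cong₂ _∨_ e (any-false g xs es)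

any-cong : {A : Set} {g g' : A → Bool} (L : List A) → (∀ z → g z ≡ g' z) → any g L ≡ any g' L
any-cong []       e = refl
any-cong (x ∷ xs) e = cong₂ _∨_ (e x) (any-cong xs e)

any-++ : {A : Set} (g : A → Bool) (xs ys : List A) → any g (xs ++ ys) ≡ any g xs ∨ any g ys
any-++ g []       ys = refl
any-++ g (x ∷ xs) ys = trans (cong (g x ∨_) (any-++ g xs ys)) (sym (BP.∨-assoc (g x) _ _))

any-map : {A B : Set} (g : B → Bool) (f : A → B) (L : List A) → any g (map f L) ≡ any (g ∘ f) L
any-map g f []       = refl
any-map g f (x ∷ xs) = cong (g (f x) ∨_) (any-map g f xs)

∨-interchange : ∀ a b c d → (a ∨ b) ∨ (c ∨ d) ≡ (a ∨ c) ∨ (b ∨ d)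
∨-interchange true  b     c d = refl
∨-interchange false true  c d = sym (BP.∨-zeroʳ c)
∨-interchange false false c d = refl

not-∨ : ∀ a b → not (a ∨ b) ≡ not a ∧ not b
not-∨ true  b = refl
not-∨ false b = refl

⊙-∧ : ∀ a b n → (a ∧ b) ⊙ n ≡ a ⊙ b ⊙ n
⊙-∧ true  b n = refl
⊙-∧ false b n = refl

⊙-not-∨ : ∀ a b n → not (a ∨ b) ⊙ n ≡ not b ⊙ not a ⊙ n
⊙-not-∨ true  true  n = refl
⊙-not-∨ true  false n = refl
⊙-not-∨ false b     n = refl

-- Inserting a new maximum

someBelow : List ℕ → List ℕ → Bool
someBelow []       ys = false
someBelow (x ∷ xs) ys = any (x <ᵇ_) ys ∨ someBelow xs ys

splitsAt : ℕ → List ℕ → Bool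
splitsAt p τ = not (someBelow (take p τ) (drop p τ))

any-insert : (g : ℕ → Bool) (M : ℕ) → g M ≡ false → (xs ys : List ℕ) → any g (xs ++ M ∷ ys) ≡ any g (xs ++ ys)
any-insert g M e []       ys = cong (_∨ any g ys) e
any-insert g M e (x ∷ xs) ys = cong (g x ∨_) (any-insert g M e xs ys)

leads132-max : ∀ M ys → All (_< M) ys → leads132 M ys ≡ false
leads132-max M []       []       = refl
leads132-max M (y ∷ ys) (p ∷ ps) =
  cong₂ _∨_ (any-false _ ys (All.map (λ {z} q → cong (_∧ (z <ᵇ y)) (<ᵇ-false (<⇒≤ q))) ps)) (leads132-max M ys ps)

-- With the maximum M as "3", x leads a new 132 iff some later entry exceeds x.
leads132-insert : ∀ M x xs ys → All (_< M) xs → All (_< M) ys →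
  leads132 x (xs ++ M ∷ ys) ≡ leads132 x (xs ++ ys) ∨ any (x <ᵇ_) ys
leads132-insert M x [] ys [] pys =
  trans (cong (_∨ leads132 x ys) (below-M ys pys)) (BP.∨-comm (any (x <ᵇ_) ys) (leads132 x ys))
  where
  below-M : ∀ L → All (_< M) L → any (λ z → (x <ᵇ z) ∧ (z <ᵇ M)) L ≡ any (x <ᵇ_) L
  below-M []      []       = refl
  below-M (z ∷ L) (q ∷ qs) =
    cong₂ _∨_ (trans (cong ((x <ᵇ z) ∧_) (<ᵇ-true q)) (BP.∧-identityʳ (x <ᵇ z))) (below-M L qs)
leads132-insert M x (y ∷ xs) ys (py ∷ pxs) pys =
  trans (cong₂ _∨_ (any-insert _ M (trans (cong ((x <ᵇ M) ∧_) (<ᵇ-false (<⇒≤ py))) (BP.∧-zeroʳ (x <ᵇ M))) xs ys)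
                   (leads132-insert M x xs ys pxs pys))
        (sym (BP.∨-assoc (any (λ z → (x <ᵇ z) ∧ (z <ᵇ y)) (xs ++ ys)) (leads132 x (xs ++ ys)) (any (x <ᵇ_) ys)))

has132-insert : ∀ M xs ys → All (_< M) xs → All (_< M) ys →
  has132 (xs ++ M ∷ ys) ≡ has132 (xs ++ ys) ∨ someBelow xs ys
has132-insert M []       ys []         pys =
  trans (cong (_∨ has132 ys) (leads132-max M ys pys)) (sym (BP.∨-identityʳ (has132 ys)))
has132-insert M (x ∷ xs) ys (px ∷ pxs) pys =
  trans (cong₂ _∨_ (leads132-insert M x xs ys pxs pys) (has132-insert M xs ys pxs pys))
        (∨-interchange (leads132 x (xs ++ ys)) (any (x <ᵇ_) ys) (has132 (xs ++ ys)) (someBelow xs ys))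

insertAll-above : ∀ y M ys → y < M → All (λ σ → any (y <ᵇ_) σ ≡ true) (insertAll M ys)
insertAll-above y M []       p = cong (_∨ false) (<ᵇ-true p) ∷ []
insertAll-above y M (z ∷ zs) p =
  cong (_∨ any (y <ᵇ_) (z ∷ zs)) (<ᵇ-true p)
  ∷ AllP.map⁺ (All.map (λ e → trans (cong ((y <ᵇ z) ∨_) e) (BP.∨-zeroʳ (y <ᵇ z))) (insertAll-above y M zs p))

drop-after-insert : ∀ p (xs σ : List ℕ) → length σ ≡ suc (length (take p xs)) →
  drop (suc p) (σ ++ drop p xs) ≡ drop p xs
drop-after-insert zero    xs       (a ∷ []) e = refl
drop-after-insert (suc p) []       (a ∷ []) e = refl
drop-after-insert (suc p) (x ∷ xs) (a ∷ σ)  e = drop-after-insert p xs σ (suc-injective e)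

insert-splitsAt : ∀ M p τ (G : List ℕ → ℕ) → All (_< M) τ →
  sumL (λ σ → splitsAt (suc p) σ ⊙ G σ) (insertAll M τ)
  ≡ splitsAt p τ ⊙ sumL (λ σ → G (σ ++ drop p τ)) (insertAll M (take p τ))
insert-splitsAt M zero [] G [] = refl
insert-splitsAt M zero (y ∷ ys) G (py ∷ pys) =
  cong₂ _+_ (cong (λ b → not (b ∨ false) ⊙ G (M ∷ y ∷ ys))
                  (any-false (M <ᵇ_) (y ∷ ys) (All.map (λ q → <ᵇ-false (<⇒≤ q)) (py ∷ pys))))
            (trans (sumL-map _ (y ∷_) (insertAll M ys))
                   (trans (sumL-congAll (All.map (λ {σ} e → cong (λ b → not (b ∨ false) ⊙ G (y ∷ σ)) e)
                                                 (insertAll-above y M ys py)))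
                          (sumL-zero (insertAll M ys))))
insert-splitsAt M (suc p) [] G [] = refl
insert-splitsAt M (suc p) (x ∷ xs) G (px ∷ pxs) = trans (cong₂ _+_ first later) (sym rhs)
  where
  open ≡-Reasoning
  d = drop p xs
  t = take p xs
  A = any (x <ᵇ_) d
  S = splitsAt p xs
  Σt = sumL (λ σ → G (x ∷ σ ++ d)) (insertAll M t)
  first : splitsAt (suc (suc p)) (M ∷ x ∷ xs) ⊙ G (M ∷ x ∷ xs) ≡ (not A ∧ S) ⊙ G (M ∷ x ∷ t ++ d)
  first = cong₂ _⊙_
    (trans (cong (λ b → not (b ∨ someBelow (take (suc p) (x ∷ xs)) (drop (suc p) (x ∷ xs))))
                 (any-false (M <ᵇ_) d (All.map (λ q → <ᵇ-false (<⇒≤ q)) (AllP.drop⁺ p pxs))))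
           (not-∨ A (someBelow t d)))
    (cong (λ z → G (M ∷ x ∷ z)) (sym (LP.take++drop≡id p xs)))
  -- M after x: recurse on xs, with x required to exceed everything after the split.
  later : sumL (λ σ → splitsAt (suc (suc p)) σ ⊙ G σ) (map (x ∷_) (insertAll M xs)) ≡ (not A ∧ S) ⊙ Σt
  later = begin
      sumL (λ σ → splitsAt (suc (suc p)) σ ⊙ G σ) (map (x ∷_) (insertAll M xs))
    ≡⟨ sumL-map _ (x ∷_) (insertAll M xs) ⟩
      sumL (λ σ → not (any (x <ᵇ_) (drop (suc p) σ) ∨ someBelow (take (suc p) σ) (drop (suc p) σ)) ⊙ G (x ∷ σ))
           (insertAll M xs)
    ≡⟨ sumL-cong (insertAll M xs) (λ σ → ⊙-not-∨ (any (x <ᵇ_) (drop (suc p) σ)) (someBelow (take (suc p) σ) (drop (suc p) σ)) (G (x ∷ σ))) ⟩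
      sumL (λ σ → splitsAt (suc p) σ ⊙ not (any (x <ᵇ_) (drop (suc p) σ)) ⊙ G (x ∷ σ)) (insertAll M xs)
    ≡⟨ insert-splitsAt M p xs (λ σ → not (any (x <ᵇ_) (drop (suc p) σ)) ⊙ G (x ∷ σ)) pxs ⟩
      S ⊙ sumL (λ σ → not (any (x <ᵇ_) (drop (suc p) (σ ++ d))) ⊙ G (x ∷ σ ++ d)) (insertAll M t)
    ≡⟨ cong (S ⊙_) (sumL-congAll (All.map (λ {σ} e → cong (λ z → not (any (x <ᵇ_) z) ⊙ G (x ∷ σ ++ d))
                                                         (drop-after-insert p xs σ e))
                                           (insertAll-length M t))) ⟩
      S ⊙ sumL (λ σ → not A ⊙ G (x ∷ σ ++ d)) (insertAll M t)
    ≡⟨ cong (S ⊙_) (sumL-⊙ (not A) (λ σ → G (x ∷ σ ++ d)) (insertAll M t)) ⟩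
      S ⊙ not A ⊙ Σt
    ≡⟨ sym (trans (cong (_⊙ Σt) (BP.∧-comm (not A) S)) (⊙-∧ S (not A) Σt)) ⟩
      (not A ∧ S) ⊙ Σt
    ∎
  rhs : splitsAt (suc p) (x ∷ xs) ⊙ sumL (λ σ → G (σ ++ d)) (insertAll M (x ∷ t))
        ≡ (not A ∧ S) ⊙ G (M ∷ x ∷ t ++ d) + (not A ∧ S) ⊙ Σt
  rhs = trans (cong (λ b → b ⊙ (G (M ∷ x ∷ t ++ d) + sumL (λ σ → G (σ ++ d)) (map (x ∷_) (insertAll M t))))
                    (not-∨ A (someBelow t d)))
        (trans (cong (λ z → (not A ∧ S) ⊙ (G (M ∷ x ∷ t ++ d) + z)) (sumL-map _ (x ∷_) (insertAll M t)))
               (⊙-+ (not A ∧ S) _ _))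

-- Decomposition of S_{m+1}(132) around the maximum

shift : ℕ → List ℕ → List ℕ
shift b = map (b +_)

insertAll-shift : (f : ℕ → ℕ) (x : ℕ) (L : List ℕ) → map (map f) (insertAll x L) ≡ insertAll (f x) (map f L)
insertAll-shift f x []       = refl
insertAll-shift f x (y ∷ ys) = cong ((f x ∷ f y ∷ map f ys) ∷_)
  (trans (trans (sym (LP.map-∘ {g = map f} {f = y ∷_} (insertAll x ys)))
                (LP.map-∘ {g = f y ∷_} {f = map f} (insertAll x ys)))
         (cong (map (f y ∷_)) (insertAll-shift f x ys)))

take-prefix : ∀ p (A B : List ℕ) → length A ≡ p → take p (A ++ B) ≡ A
take-prefix zero    []      B e = refl
take-prefix (suc p) (a ∷ A) B e = cong (a ∷_) (take-prefix p A B (suc-injective e))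

drop-prefix : ∀ p (A B : List ℕ) → length A ≡ p → drop p (A ++ B) ≡ B
drop-prefix zero    []      B e = refl
drop-prefix (suc p) (a ∷ A) B e = drop-prefix p A B (suc-injective e)

splitsAt-sum : ∀ p b (G : List ℕ → ℕ) →
  sumL (λ τ → splitsAt p τ ⊙ G τ) (perms (p + b))
  ≡ sumL (λ α → sumL (λ β → G (shift b α ++ β)) (perms b)) (perms p)
splitsAt-sum zero    b G = sym (+-identityʳ _)
splitsAt-sum (suc p) b G = begin
    sumL (λ τ → splitsAt (suc p) τ ⊙ G τ) (concatMap (insertAll M) (perms (p + b)))
  ≡⟨ sumL-concatMap _ (insertAll M) (perms (p + b)) ⟩
    sumL (λ τ' → sumL (λ τ → splitsAt (suc p) τ ⊙ G τ) (insertAll M τ')) (perms (p + b))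
  ≡⟨ sumL-congAll (All.map (λ {τ'} sh → insert-splitsAt M p τ' G (All.map (λ q → s≤s (proj₂ q)) (proj₂ sh)))
                           (perms-shape (p + b))) ⟩
    sumL (λ τ' → splitsAt p τ' ⊙ G' τ') (perms (p + b))
  ≡⟨ splitsAt-sum p b G' ⟩
    sumL (λ α' → sumL (λ β → G' (shift b α' ++ β)) (perms b)) (perms p)
  ≡⟨ sumL-congAll (All.map (λ {α'} sh → regroup α' (proj₁ sh)) (perms-shape p)) ⟩
    sumL (λ α' → sumL (λ α → sumL (λ β → G (shift b α ++ β)) (perms b)) (insertAll (suc p) α')) (perms p)
  ≡⟨ sym (sumL-concatMap _ (insertAll (suc p)) (perms p)) ⟩
    sumL (λ α → sumL (λ β → G (shift b α ++ β)) (perms b)) (perms (suc p))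
  ∎
  where
  open ≡-Reasoning
  M = suc (p + b)
  G' : List ℕ → ℕ
  G' τ' = sumL (λ σ → G (σ ++ drop p τ')) (insertAll M (take p τ'))
  -- Inserting M into shift b α' is shifting an insertion of p+1 into α'.
  regroup : ∀ α' → length α' ≡ p →
    sumL (λ β → G' (shift b α' ++ β)) (perms b)
    ≡ sumL (λ α → sumL (λ β → G (shift b α ++ β)) (perms b)) (insertAll (suc p) α')
  regroup α' len = begin
      sumL (λ β → G' (shift b α' ++ β)) (perms b)
    ≡⟨ sumL-cong (perms b) (λ β → cong₂ (λ t d → sumL (λ σ → G (σ ++ d)) (insertAll M t))
                                        (take-prefix p (shift b α') β len') (drop-prefix p (shift b α') β len')) ⟩
      sumL (λ β → sumL (λ σ → G (σ ++ β)) (insertAll M (shift b α'))) (perms b)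
    ≡⟨ sym (sumL-swap (λ σ β → G (σ ++ β)) (insertAll M (shift b α')) (perms b)) ⟩
      sumL (λ σ → sumL (λ β → G (σ ++ β)) (perms b)) (insertAll M (shift b α'))
    ≡⟨ cong (sumL (λ σ → sumL (λ β → G (σ ++ β)) (perms b)))
            (sym (trans (insertAll-shift (b +_) (suc p) α') (cong (λ z → insertAll z (shift b α')) b+[1+p]≡M))) ⟩
      sumL (λ σ → sumL (λ β → G (σ ++ β)) (perms b)) (map (shift b) (insertAll (suc p) α'))
    ≡⟨ sumL-map _ (shift b) (insertAll (suc p) α') ⟩
      sumL (λ α → sumL (λ β → G (shift b α ++ β)) (perms b)) (insertAll (suc p) α')
    ∎
    where
    len' = trans (LP.length-map (b +_) α') len
    b+[1+p]≡M : b + suc p ≡ M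
    b+[1+p]≡M = trans (+-suc b p) (cong suc (+-comm b p))

-- Shifting preserves relative order, hence 132-containment.
<ᵇ-shift : ∀ b x y → ((b + x) <ᵇ (b + y)) ≡ (x <ᵇ y)
<ᵇ-shift zero    x y = refl
<ᵇ-shift (suc b) x y = <ᵇ-shift b x y

leads132-shift : ∀ b x ys → leads132 (b + x) (shift b ys) ≡ leads132 x ys
leads132-shift b x []       = refl
leads132-shift b x (y ∷ ys) = cong₂ _∨_
  (trans (any-map _ (b +_) ys) (any-cong ys (λ z → cong₂ _∧_ (<ᵇ-shift b x z) (<ᵇ-shift b z y))))
  (leads132-shift b x ys)

has132-shift : ∀ b xs → has132 (shift b xs) ≡ has132 xs
has132-shift b []       = refl
has132-shift b (x ∷ xs) = cong₂ _∨_ (leads132-shift b x xs) (has132-shift b xs)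

leads132-low : ∀ a B → All (_≤ a) B → leads132 a B ≡ false
leads132-low a []      []       = refl
leads132-low a (y ∷ B) (q ∷ qs) =
  cong₂ _∨_ (any-false _ B (All.map (λ {z} r → cong (_∧ (z <ᵇ y)) (<ᵇ-false r)) qs)) (leads132-low a B qs)

leads132-++ : ∀ a A B → All (_≤ a) B → leads132 a (A ++ B) ≡ leads132 a A
leads132-++ a []      B qs = leads132-low a B qs
leads132-++ a (y ∷ A) B qs = cong₂ _∨_
  (trans (any-++ _ A B)
         (trans (cong (any (λ z → (a <ᵇ z) ∧ (z <ᵇ y)) A ∨_)
                      (any-false _ B (All.map (λ {z} r → cong (_∧ (z <ᵇ y)) (<ᵇ-false r)) qs)))
                (BP.∨-identityʳ _)))
  (leads132-++ a A B qs)

has132-++ : ∀ t A B → All (t <_) A → All (_≤ t) B → has132 (A ++ B) ≡ has132 A ∨ has132 B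
has132-++ t []      B []         qs = refl
has132-++ t (a ∷ A) B (pa ∷ pas) qs =
  trans (cong₂ _∨_ (leads132-++ a A B (All.map (λ r → ≤-trans r (<⇒≤ pa)) qs)) (has132-++ t A B pas qs))
        (sym (BP.∨-assoc (leads132 a A) (has132 A) (has132 B)))

insertAll-positions : ∀ x τ → insertAll x τ ≡ applyUpTo (λ p → take p τ ++ x ∷ drop p τ) (suc (length τ))
insertAll-positions x []       = refl
insertAll-positions x (y ∷ ys) = cong ((x ∷ y ∷ ys) ∷_)
  (trans (cong (map (y ∷_)) (insertAll-positions x ys))
         (LP.map-applyUpTo (λ p → take p ys ++ x ∷ drop p ys) (y ∷_) (suc (length ys))))

sum-avoiding : (f : List ℕ → ℕ) (L : List (List ℕ)) →
  sumL (λ σ → not (has132 σ) ⊙ f σ) L ≡ sumL f (filter (λ σ → T? (not (contains132 σ))) L)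
sum-avoiding f L =
  trans (sumL-cong L (λ σ → cong (λ b → not b ⊙ f σ) (sym (contains132≡has132 σ))))
        (sym (sumL-filter (λ σ → not (contains132 σ)) f L))

sum-avoiding₂ : ∀ a b (K : List ℕ → List ℕ → ℕ) →
  sumL (λ α → sumL (λ β → not (has132 α ∨ has132 β) ⊙ K α β) (perms b)) (perms a)
  ≡ sumL (λ α → sumL (K α) (perms132 b)) (perms132 a)
sum-avoiding₂ a b K = begin
    sumL (λ α → sumL (λ β → not (has132 α ∨ has132 β) ⊙ K α β) (perms b)) (perms a)
  ≡⟨ sumL-cong (perms a) (λ α → trans (sumL-cong (perms b) (λ β → guards α β))
                                      (sumL-⊙ (not (has132 α)) _ (perms b))) ⟩
    sumL (λ α → not (has132 α) ⊙ sumL (λ β → not (has132 β) ⊙ K α β) (perms b)) (perms a)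
  ≡⟨ sumL-cong (perms a) (λ α → cong (not (has132 α) ⊙_) (sum-avoiding (K α) (perms b))) ⟩
    sumL (λ α → not (has132 α) ⊙ sumL (K α) (perms132 b)) (perms a)
  ≡⟨ sum-avoiding _ (perms a) ⟩
    sumL (λ α → sumL (K α) (perms132 b)) (perms132 a)
  ∎
  where
  open ≡-Reasoning
  guards : ∀ α β → not (has132 α ∨ has132 β) ⊙ K α β ≡ not (has132 α) ⊙ not (has132 β) ⊙ K α β
  guards α β = trans (cong (λ c → not c ⊙ K α β) (BP.∨-comm (has132 α) (has132 β)))
                     (⊙-not-∨ (has132 β) (has132 α) (K α β))

avoiding-insertions : ∀ m (F : List ℕ → ℕ) τ → Shape m τ →
  sumL (λ σ → not (has132 σ) ⊙ F σ) (insertAll (suc m) τ)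
  ≡ Σr (suc m) (λ p → splitsAt p τ ⊙ not (has132 τ) ⊙ F (take p τ ++ suc m ∷ drop p τ))
avoiding-insertions m F τ (len , bnd) =
  trans (cong (sumL H) (insertAll-positions M τ))
  (trans (sumL-applyUpTo H (λ p → take p τ ++ M ∷ drop p τ) (suc (length τ)))
  (trans (cong (λ k → Σr (suc k) (λ p → H (take p τ ++ M ∷ drop p τ))) len)
         (Σr-cong (suc m) (λ p _ → at-position p))))
  where
  M = suc m
  H : List ℕ → ℕ
  H σ = not (has132 σ) ⊙ F σ
  below-M : All (_< M) τ
  below-M = All.map (λ q → s≤s (proj₂ q)) bnd
  at-position : ∀ p → H (take p τ ++ M ∷ drop p τ)
                      ≡ splitsAt p τ ⊙ not (has132 τ) ⊙ F (take p τ ++ M ∷ drop p τ)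
  at-position p =
    trans (cong (λ b → not b ⊙ F (take p τ ++ M ∷ drop p τ))
                (has132-insert M (take p τ) (drop p τ) (AllP.take⁺ p below-M) (AllP.drop⁺ p below-M)))
    (trans (⊙-not-∨ (has132 (take p τ ++ drop p τ)) (someBelow (take p τ) (drop p τ)) _)
           (cong (λ z → splitsAt p τ ⊙ not (has132 z) ⊙ F (take p τ ++ M ∷ drop p τ)) (LP.take++drop≡id p τ)))

-- For a fixed position p, the admissible τ are the words (shift b α) ++ β,
-- and such a word avoids 132 iff α and β do.
avoiding-at-position : ∀ p b (F : List ℕ → ℕ) →
  sumL (λ τ → splitsAt p τ ⊙ not (has132 τ) ⊙ F (take p τ ++ suc (p + b) ∷ drop p τ)) (perms (p + b))
  ≡ sumL (λ α → sumL (λ β → F (shift b α ++ suc (p + b) ∷ β)) (perms132 b)) (perms132 p)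
avoiding-at-position p b F =
  trans (splitsAt-sum p b G)
  (trans (sumL-congAll (All.map (λ {α} sα → sumL-congAll (All.map (λ {β} sβ → pieces α β sα sβ) (perms-shape b)))
                                (perms-shape p)))
         (sum-avoiding₂ p b (λ α β → F (shift b α ++ M ∷ β))))
  where
  M = suc (p + b)
  G : List ℕ → ℕ
  G τ = not (has132 τ) ⊙ F (take p τ ++ M ∷ drop p τ)
  pieces : ∀ α β → Shape p α → Shape b β → G (shift b α ++ β) ≡ not (has132 α ∨ has132 β) ⊙ F (shift b α ++ M ∷ β)
  pieces α β (lα , bα) (lβ , bβ) = cong₂ (λ c z → not c ⊙ F z)
    (trans (has132-++ b (shift b α) β (AllP.map⁺ (All.map (λ q → m<m+n b (proj₁ q)) bα)) (All.map proj₂ bβ))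
           (cong (_∨ has132 β) (has132-shift b α)))
    (cong₂ (λ x y → x ++ M ∷ y) (take-prefix p (shift b α) β len) (drop-prefix p (shift b α) β len))
    where len = trans (LP.length-map (b +_) α) lα

decomposition : ∀ m (F : List ℕ → ℕ) →
  sumL F (perms132 (suc m))
  ≡ Σ₂ m (λ p b → sumL (λ α → sumL (λ β → F (shift b α ++ suc m ∷ β)) (perms132 b)) (perms132 p))
decomposition m F = begin
    sumL F (perms132 (suc m))
  ≡⟨ sym (sum-avoiding F (perms (suc m))) ⟩
    sumL (λ σ → not (has132 σ) ⊙ F σ) (concatMap (insertAll (suc m)) (perms m))
  ≡⟨ sumL-concatMap _ (insertAll (suc m)) (perms m) ⟩
    sumL (λ τ → sumL (λ σ → not (has132 σ) ⊙ F σ) (insertAll (suc m) τ)) (perms m)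
  ≡⟨ sumL-congAll (All.map (avoiding-insertions m F _) (perms-shape m)) ⟩
    sumL (λ τ → Σr (suc m) (G τ)) (perms m)
  ≡⟨ sumL-Σr (suc m) G (perms m) ⟩
    Σr (suc m) (λ p → sumL (λ τ → G τ p) (perms m))
  ≡⟨ Σr-cong (suc m) (λ p p<1+m → at-position p (m ∸ p) (m+[n∸m]≡n (≤-pred p<1+m))) ⟩
    Σr (suc m) (λ p → Pieces p (m ∸ p))
  ≡⟨ Σr-as-Σ₂ m Pieces ⟩
    Σ₂ m Pieces
  ∎
  where
  open ≡-Reasoning
  G : List ℕ → ℕ → ℕ
  G τ p = splitsAt p τ ⊙ not (has132 τ) ⊙ F (take p τ ++ suc m ∷ drop p τ)
  Pieces : ℕ → ℕ → ℕ
  Pieces p b = sumL (λ α → sumL (λ β → F (shift b α ++ suc m ∷ β)) (perms132 b)) (perms132 p)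
  at-position : ∀ p b → p + b ≡ m → sumL (λ τ → G τ p) (perms m) ≡ Pieces p b
  at-position p b refl = avoiding-at-position p b F

-- How mmp splits around the maximum

countB-false : {A : Set} (g : A → Bool) (L : List A) → All (λ z → g z ≡ false) L → countB g L ≡ 0
countB-false g []       []       = refl
countB-false g (x ∷ xs) (e ∷ es) = trans (cong (λ b → if b then suc (countB g xs) else countB g xs) e)
                                         (countB-false g xs es)

countB-++ : {A : Set} (g : A → Bool) (xs ys : List A) → countB g (xs ++ ys) ≡ countB g xs + countB g ys
countB-++ g []       ys = refl
countB-++ g (x ∷ xs) ys with g x
... | true  = cong suc (countB-++ g xs ys)
... | false = countB-++ g xs ys

countB-map : {A B : Set} (g : B → Bool) (f : A → B) (L : List A) → countB g (map f L) ≡ countB (g ∘ f) L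
countB-map g f []       = refl
countB-map g f (x ∷ xs) = cong (λ c → if g (f x) then suc c else c) (countB-map g f xs)

countB-cong : {A : Set} {g g' : A → Bool} (L : List A) → (∀ z → g z ≡ g' z) → countB g L ≡ countB g' L
countB-cong []       e = refl
countB-cong (x ∷ xs) e = cong₂ (λ b c → if b then suc c else c) (e x) (countB-cong xs e)

≤ᵇ-suc : ∀ k c → (suc k ≤ᵇ suc c) ≡ (k ≤ᵇ c)
≤ᵇ-suc zero    c = refl
≤ᵇ-suc (suc k) c = refl

mmpFrom-prefix : ∀ k P P' β → All (λ y → any (_<ᵇ y) P ≡ any (_<ᵇ y) P') β → mmpFrom k P β ≡ mmpFrom k P' β
mmpFrom-prefix k P P' []       []       = refl
mmpFrom-prefix k P P' (y ∷ ys) (e ∷ es) =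
  cong₂ _+_ (cong (λ z → ((k ≤ᵇ countB (y <ᵇ_) ys) ∧ not z) ⊙ 1) e)
            (mmpFrom-prefix k (y ∷ P) (y ∷ P') ys (All.map (λ {z} e' → cong ((y <ᵇ z) ∨_) e') es))

mmpFrom-shift : ∀ k b P xs → mmpFrom k (shift b P) (shift b xs) ≡ mmpFrom k P xs
mmpFrom-shift k b P []       = refl
mmpFrom-shift k b P (x ∷ xs) = cong₂ _+_
  (cong₂ (λ c d → ((k ≤ᵇ c) ∧ not d) ⊙ 1)
    (trans (countB-map _ (b +_) xs) (countB-cong xs (λ z → <ᵇ-shift b x z)))
    (trans (any-map _ (b +_) P) (any-cong P (λ z → <ᵇ-shift b z x))))
  (mmpFrom-shift k b (x ∷ P) xs)

mmpFrom-after : ∀ k t M P β → All (t <_) P → t < M → All (_≤ t) β → mmpFrom k (M ∷ P) β ≡ mmpₛ k β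
mmpFrom-after k t M P β tP tM βt = mmpFrom-prefix k (M ∷ P) [] β (All.map (λ {y} q →
  cong₂ _∨_ (<ᵇ-false (≤-trans q (<⇒≤ tM))) (any-false _ P (All.map (λ r → <ᵇ-false (≤-trans q (<⇒≤ r))) tP))) βt)

-- For A above t < M, each entry of A gains exactly one larger later entry (M)
-- from "M ∷ β", while M itself has no larger later entry:
-- mmp_{k+1}(A M β) = mmp_k A + mmp_{k+1} β.
mmpFrom-split : ∀ k t M P A β → All (t <_) P → All (t <_) A → All (_< M) A → t < M → All (_≤ t) β →
  mmpFrom (suc k) P (A ++ M ∷ β) ≡ mmpFrom k P A + mmpₛ (suc k) β
mmpFrom-split k t M P [] β tP tA AM tM βt =
  trans (cong (λ c → ((suc k ≤ᵇ c) ∧ not (any (_<ᵇ M) P)) ⊙ 1 + mmpFrom (suc k) (M ∷ P) β)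
              (countB-false _ β (All.map (λ q → <ᵇ-false (≤-trans q (<⇒≤ tM))) βt)))
        (mmpFrom-after (suc k) t M P β tP tM βt)
mmpFrom-split k t M P (a ∷ A) β tP (ta ∷ tA) (aM ∷ AM) tM βt =
  trans (cong₂ _+_ (cong (λ c → (c ∧ not (any (_<ᵇ a) P)) ⊙ 1) (trans (cong (suc k ≤ᵇ_) larger) (≤ᵇ-suc k _)))
                   (mmpFrom-split k t M (a ∷ P) A β (ta ∷ tP) tA AM tM βt))
        (sym (+-assoc (((k ≤ᵇ countB (a <ᵇ_) A) ∧ not (any (_<ᵇ a) P)) ⊙ 1) (mmpFrom k (a ∷ P) A) (mmpₛ (suc k) β)))
  where
  larger : countB (a <ᵇ_) (A ++ M ∷ β) ≡ suc (countB (a <ᵇ_) A)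
  larger = trans (countB-++ (a <ᵇ_) A (M ∷ β))
    (trans (cong (λ b → countB (a <ᵇ_) A + (if b then suc (countB (a <ᵇ_) β) else countB (a <ᵇ_) β)) (<ᵇ-true aM))
    (trans (cong (λ z → countB (a <ᵇ_) A + suc z) (countB-false _ β (All.map (λ q → <ᵇ-false (≤-trans q (<⇒≤ ta))) βt)))
           (+-comm _ 1)))

-- For k = 0 the maximum is a point iff it comes first.
mmp₀-max-first : ∀ t M β → t < M → All (_≤ t) β → mmpₛ 0 (M ∷ β) ≡ suc (mmpₛ 0 β)
mmp₀-max-first t M β tM βt = cong suc (mmpFrom-after 0 t M [] β [] tM βt)

mmp₀-split : ∀ t M P a A β → All (t <_) P → All (t <_) (a ∷ A) → All (_< M) (a ∷ A) → t < M → All (_≤ t) β →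
  mmpFrom 0 P (a ∷ A ++ M ∷ β) ≡ mmpFrom 0 P (a ∷ A) + mmpₛ 0 β
mmp₀-split t M P a [] β tP (ta ∷ []) (aM ∷ []) tM βt =
  trans (cong (λ z → not (any (_<ᵇ a) P) ⊙ 1 + z)
          (trans (cong (λ b → not (b ∨ any (_<ᵇ M) P) ⊙ 1 + mmpFrom 0 (M ∷ a ∷ P) β) (<ᵇ-true aM))
                 (mmpFrom-after 0 t M (a ∷ P) β (ta ∷ tP) tM βt)))
        (cong (_+ mmpₛ 0 β) (sym (+-identityʳ (not (any (_<ᵇ a) P) ⊙ 1))))
mmp₀-split t M P a (a' ∷ A) β tP (ta ∷ tA) (aM ∷ AM) tM βt =
  trans (cong (not (any (_<ᵇ a) P) ⊙ 1 +_) (mmp₀-split t M (a ∷ P) a' A β (ta ∷ tP) tA AM tM βt))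
        (sym (+-assoc (not (any (_<ᵇ a) P) ⊙ 1) (mmpFrom 0 (a ∷ P) (a' ∷ A)) (mmpₛ 0 β)))

countB≤length : {A : Set} (g : A → Bool) (L : List A) → countB g L ≤ length L
countB≤length g []       = z≤n
countB≤length g (z ∷ zs) with g z
... | true  = s≤s (countB≤length g zs)
... | false = m≤n⇒m≤1+n (countB≤length g zs)

-- mmp_k σ ≤ |σ| - k: an mmp_k point has k larger entries after it.
mmpFrom-bound : ∀ k P xs → mmpFrom k P xs ≤ length xs ∸ k
mmpFrom-bound k P [] = z≤n
mmpFrom-bound k P (x ∷ ys) with k ≤ᵇ countB (x <ᵇ_) ys in eq
... | true  = begin
    not (any (_<ᵇ x) P) ⊙ 1 + mmpFrom k (x ∷ P) ys ≤⟨ +-mono-≤ (indicator≤1 (not (any (_<ᵇ x) P))) (mmpFrom-bound k (x ∷ P) ys) ⟩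
    1 + (length ys ∸ k)                             ≡⟨ sym (+-∸-assoc 1 k≤|ys|) ⟩
    suc (length ys) ∸ k                             ∎
  where
  open ≤-Reasoning
  indicator≤1 : ∀ b → b ⊙ 1 ≤ 1
  indicator≤1 true  = ≤-refl
  indicator≤1 false = z≤n
  k≤|ys| : k ≤ length ys
  k≤|ys| = ≤-trans (≤ᵇ⇒≤ k _ (subst T (sym eq) _)) (countB≤length (x <ᵇ_) ys)
... | false = ≤-trans (mmpFrom-bound k (x ∷ P) ys) (∸-monoˡ-≤ k (n≤1+n (length ys)))

count : (List ℕ → ℕ) → ℕ → List (List ℕ) → ℕ
count f r L = sumL (λ x → (f x ≡ᵇ r) ⊙ 1) L

N : ℕ → ℕ → ℕ → ℕ
N k m r = count (mmpₛ k) r (perms132 m)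

coeffQ132≡N : ∀ m k r → coeffQ132 m k r ≡ N k m r
coeffQ132≡N m k r = trans (countB-as-sum _ (perms132 m))
  (sumL-cong (perms132 m) (λ σ → cong (λ z → (z ≡ᵇ r) ⊙ 1) (mmp≡mmpₛ k σ)))

pairCount : (List ℕ → ℕ) → (List ℕ → ℕ) → ℕ → List (List ℕ) → List (List ℕ) → ℕ
pairCount f g r L1 L2 = sumL (λ α → sumL (λ β → (f α + g β ≡ᵇ r) ⊙ 1) L2) L1

≡ᵇ-refl : ∀ x → (x ≡ᵇ x) ≡ true
≡ᵇ-refl x = dec-true (x ≟ x) refl

≡ᵇ-false : ∀ {x y} → x ≢ y → (x ≡ᵇ y) ≡ false
≡ᵇ-false {x} {y} x≢y = dec-false (x ≟ y) x≢y

≡ᵇ-+ : ∀ a x y → (a + x ≡ᵇ a + y) ≡ (x ≡ᵇ y)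
≡ᵇ-+ zero    x y = refl
≡ᵇ-+ (suc a) x y = ≡ᵇ-+ a x y

pairCount-above : ∀ {f g r L1 L2 A B} → All (λ α → f α ≤ A) L1 → All (λ β → g β ≤ B) L2 → A + B < r →
  pairCount f g r L1 L2 ≡ 0
pairCount-above {f} {g} {r} {L1} {L2} fA gB A+B<r =
  trans (sumL-congAll (All.map (λ {α} fα≤A →
          trans (sumL-congAll (All.map (λ {β} gβ≤B →
                   cong (_⊙ 1) (≡ᵇ-false (<⇒≢ (≤-<-trans (+-mono-≤ fα≤A gβ≤B) A+B<r)))) gB))
                (sumL-zero L2)) fA))
        (sumL-zero L1)

pairCount-top : ∀ {f g r L1 L2 A B} → All (λ α → f α ≤ A) L1 → All (λ β → g β ≤ B) L2 → A + B ≡ r →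
  pairCount f g r L1 L2 ≡ count f A L1 * count g B L2
pairCount-top {f} {g} {r} {L1} {L2} {A} {B} fA gB refl =
  trans (sumL-congAll (All.map (λ {α} fα≤A → sumL-congAll (All.map (λ {β} gβ≤B → both α β fα≤A gβ≤B) gB)) fA))
        (sumL-* (λ α → (f α ≡ᵇ A) ⊙ 1) (λ β → (g β ≡ᵇ B) ⊙ 1) L1 L2)
  where
  both : ∀ α β → f α ≤ A → g β ≤ B → (f α + g β ≡ᵇ A + B) ⊙ 1 ≡ ((f α ≡ᵇ A) ⊙ 1) * ((g β ≡ᵇ B) ⊙ 1)
  both α β fα≤A gβ≤B with m≤n⇒m<n∨m≡n fα≤A
  ... | inj₂ fα≡A rewrite fα≡A | ≡ᵇ-refl A | ≡ᵇ-+ A (g β) B = sym (+-identityʳ _)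
  ... | inj₁ fα<A rewrite ≡ᵇ-false (<⇒≢ fα<A) | ≡ᵇ-false (<⇒≢ (+-mono-<-≤ fα<A gβ≤B)) = refl

pairs : ℕ → ℕ → ℕ → ℕ → ℕ → ℕ
pairs k j r p b = pairCount (mmpₛ k) (mmpₛ j) r (perms132 p) (perms132 b)

mmp-bound : ∀ k m → All (λ σ → mmpₛ k σ ≤ m ∸ k) (perms132 m)
mmp-bound k m = All.map (λ {σ} sh → subst (λ z → mmpₛ k σ ≤ z ∸ k) (proj₁ sh) (mmpFrom-bound k [] σ))
                        (perms132-shape m)

pairs-above : ∀ k j r p b → (p ∸ k) + (b ∸ j) < r → pairs k j r p b ≡ 0
pairs-above k j r p b = pairCount-above (mmp-bound k p) (mmp-bound j b)

pairs-top : ∀ k j r p b → (p ∸ k) + (b ∸ j) ≡ r → pairs k j r p b ≡ N k p (p ∸ k) * N j b (b ∸ j)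
pairs-top k j r p b = pairCount-top (mmp-bound k p) (mmp-bound j b)

pairs-emptyˡ : ∀ k j r b → pairs k j r 0 b ≡ N j b r
pairs-emptyˡ k j r b = +-identityʳ _

pairs-emptyʳ : ∀ k j r p → pairs k j r p 0 ≡ N k p r
pairs-emptyʳ k j r p = sumL-cong (perms132 p) (λ α →
  trans (+-identityʳ _) (cong (λ z → (z ≡ᵇ r) ⊙ 1) (+-identityʳ (mmpₛ k α))))

shift-above : ∀ {p} b α → Shape p α → All (b <_) (shift b α)
shift-above b α (_ , bα) = AllP.map⁺ (All.map (λ q → m<m+n b (proj₁ q)) bα)

shift-below : ∀ {p m} b α → p + b ≡ m → Shape p α → All (_< suc m) (shift b α)
shift-below {p} b α p+b≡m (_ , bα) = AllP.map⁺ (All.map (λ q → s≤s (begin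
    b + _ ≤⟨ +-monoʳ-≤ b (proj₂ q) ⟩
    b + p ≡⟨ trans (+-comm b p) p+b≡m ⟩
    _     ∎)) bα)
  where open ≤-Reasoning

N-split : ∀ k m r → N (suc k) (suc m) r ≡ Σ₂ m (pairs k (suc k) r)
N-split k m r = trans (decomposition m (λ σ → (mmpₛ (suc k) σ ≡ᵇ r) ⊙ 1)) (Σ₂-cong m (λ p b p+b≡m →
  sumL-congAll (All.map (λ {α} sα → sumL-congAll (All.map (λ {β} sβ →
    cong (λ z → (z ≡ᵇ r) ⊙ 1) (split p b α β p+b≡m sα sβ)) (perms132-shape b))) (perms132-shape p))))
  where
  split : ∀ p b α β → p + b ≡ m → Shape p α → Shape b β →
    mmpₛ (suc k) (shift b α ++ suc m ∷ β) ≡ mmpₛ k α + mmpₛ (suc k) β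
  split p b α β p+b≡m sα (_ , bβ) =
    trans (mmpFrom-split k b (suc m) [] (shift b α) β [] (shift-above b α sα) (shift-below b α p+b≡m sα)
                         (s≤s (subst (b ≤_) p+b≡m (m≤n+m b p))) (All.map proj₂ bβ))
          (cong (_+ mmpₛ (suc k) β) (mmpFrom-shift k b [] α))

N₀-split : ∀ m r → N 0 (suc (suc m)) (suc r) ≡ N 0 (suc m) r + Σ₂ m (λ p b → pairs 0 0 (suc r) (suc p) b)
N₀-split m r = trans (decomposition (suc m) F) (cong₂ _+_ max-first (Σ₂-cong m (λ p b p+b≡m →
  sumL-congAll (All.map (λ {α} sα → sumL-congAll (All.map (λ {β} sβ →
    cong (λ z → (z ≡ᵇ suc r) ⊙ 1) (split p b α β p+b≡m sα sβ)) (perms132-shape b))) (perms132-shape (suc p))))))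
  where
  F : List ℕ → ℕ
  F σ = (mmpₛ 0 σ ≡ᵇ suc r) ⊙ 1
  max-first : sumL (λ β → F (suc (suc m) ∷ β)) (perms132 (suc m)) + 0 ≡ N 0 (suc m) r
  max-first = trans (+-identityʳ _) (sumL-congAll (All.map (λ {β} (_ , bβ) →
    cong (λ z → (z ≡ᵇ suc r) ⊙ 1) (mmp₀-max-first (suc m) (suc (suc m)) β ≤-refl (All.map proj₂ bβ)))
    (perms132-shape (suc m))))
  split : ∀ p b α β → p + b ≡ m → Shape (suc p) α → Shape b β →
    mmpₛ 0 (shift b α ++ suc (suc m) ∷ β) ≡ mmpₛ 0 α + mmpₛ 0 β
  split p b (a ∷ A) β p+b≡m sα (_ , bβ) =
    trans (mmp₀-split b (suc (suc m)) [] (b + a) (shift b A) β []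
                      (shift-above b (a ∷ A) sα) (shift-below b (a ∷ A) (cong suc p+b≡m) sα)
                      (s≤s (m≤n⇒m≤1+n (subst (b ≤_) p+b≡m (m≤n+m b p)))) (All.map proj₂ bβ))
          (cong (_+ mmpₛ 0 β) (mmpFrom-shift 0 b [] (a ∷ A)))

-- Extremal counts

split-∸ : ∀ {p b m} k → p + b ≡ m → (p ∸ k) + (b ∸ k) ≤ m ∸ k
split-∸ {p} {b} k refl = go p b k
  where
  go : ∀ p b k → (p ∸ k) + (b ∸ k) ≤ (p + b) ∸ k
  go p       b zero    = ≤-refl
  go zero    b (suc k) = ≤-refl
  go (suc p) b (suc k) = ≤-trans (+-monoʳ-≤ (p ∸ k) (∸-monoʳ-≤ b (n≤1+n k))) (go p b k)

1+k+d∸k : ∀ k d → suc (k + d) ∸ k ≡ suc d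
1+k+d∸k k d = trans (cong (_∸ k) (sym (+-suc k d))) (m+n∸m≡n k (suc d))

pascal : ∀ m → suc m + suc m C 2 ≡ suc (suc m) C 2
pascal m = trans (cong (_+ suc m C 2) (sym (nC1≡n (suc m)))) (nCk+nC[k+1]≡[n+1]C[k+1] (suc m) 1)

-- mmp_0 counts left-to-right minima, so only the decreasing permutation m…1
-- has mmp_0 = m.
N₀-diag : ∀ m → N 0 m m ≡ 1
N₀-diag zero          = refl
N₀-diag (suc zero)    = refl
N₀-diag (suc (suc m)) = begin
    N 0 (suc (suc m)) (suc (suc m))
  ≡⟨ N₀-split m (suc m) ⟩
    N 0 (suc m) (suc m) + Σ₂ m (λ p b → pairs 0 0 (suc (suc m)) (suc p) b)
  ≡⟨ cong₂ _+_ (N₀-diag (suc m)) (Σ₂-vanish m (λ p b p+b≡m →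
       pairs-above 0 0 (suc (suc m)) (suc p) b (s≤s (s≤s (≤-reflexive p+b≡m))))) ⟩
    1
  ∎
  where open ≡-Reasoning

N₀-subdiag : ∀ m → N 0 (suc m) m ≡ suc m C 2
N₀-subdiag zero    = refl
N₀-subdiag (suc m) = begin
    N 0 (suc (suc m)) (suc m)
  ≡⟨ N₀-split m m ⟩
    N 0 (suc m) m + Σ₂ m (λ p b → pairs 0 0 (suc m) (suc p) b)
  ≡⟨ cong₂ _+_ (N₀-subdiag m) (Σ₂-ones m (λ p b p+b≡m →
       trans (pairs-top 0 0 (suc m) (suc p) b (cong suc p+b≡m)) (cong₂ _*_ (N₀-diag (suc p)) (N₀-diag b)))) ⟩
    suc m C 2 + suc m
  ≡⟨ +-comm (suc m C 2) (suc m) ⟩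
    suc m + suc m C 2
  ≡⟨ pascal m ⟩
    suc (suc m) C 2
  ∎
  where open ≡-Reasoning

-- For k < m exactly one σ ∈ S_m(132) has the maximal number m - k of mmp_k
-- points: by the decomposition its maximum must come last.
N-top : ∀ k m → k < m → N k m (m ∸ k) ≡ 1
N-top zero    m             _               = N₀-diag m
N-top (suc k) (suc (suc m)) (s≤s 1+k≤1+m) = begin
    N (suc k) (suc (suc m)) (suc m ∸ k)
  ≡⟨ N-split k (suc m) (suc m ∸ k) ⟩
    Σ₂ (suc m) (pairs k (suc k) (suc m ∸ k))
  ≡⟨ Σ₂-last m (pairs k (suc k) (suc m ∸ k)) ⟩
    Σ₂ m (λ p b → pairs k (suc k) (suc m ∸ k) p (suc b)) + pairs k (suc k) (suc m ∸ k) (suc m) 0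
  ≡⟨ cong₂ _+_ (Σ₂-vanish m below) (trans (pairs-emptyʳ k (suc k) _ (suc m)) (N-top k (suc m) 1+k≤1+m)) ⟩
    1
  ∎
  where
  open ≡-Reasoning
  below : ∀ p b → p + b ≡ m → pairs k (suc k) (suc m ∸ k) p (suc b) ≡ 0
  below p b p+b≡m = pairs-above k (suc k) _ p (suc b)
    (subst ((p ∸ k) + (b ∸ k) <_) (sym (+-∸-assoc 1 (≤-pred 1+k≤1+m))) (s≤s (split-∸ k p+b≡m)))

N₁-top : ∀ b → N 1 (suc b) b ≡ 1
N₁-top zero    = refl
N₁-top (suc b) = N-top 1 (suc (suc b)) (s≤s (s≤s z≤n))

-- With n = d + 3 and k+1 in place of k: N (k+1) (n + k) (n - 2) = 2k + C(n,2).
-- Raising k keeps the count with the maximum in last place and adds two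
-- permutations: one with the maximum first, one with it second to last.
main : ∀ k d → N (suc k) (3 + (k + d)) (suc d) ≡ 2 * k + (3 + d) C 2
main zero d = begin
    N 1 (3 + d) (suc d)
  ≡⟨ N-split 0 (2 + d) (suc d) ⟩
    Σ₂ (2 + d) (pairs 0 1 (suc d))
  ≡⟨ Σ₂-last (suc d) (pairs 0 1 (suc d)) ⟩
    Σ₂ (suc d) (λ p b → pairs 0 1 (suc d) p (suc b)) + pairs 0 1 (suc d) (2 + d) 0
  ≡⟨ cong₂ _+_ (Σ₂-ones (suc d) (λ p b p+b≡1+d →
                  trans (pairs-top 0 1 (suc d) p (suc b) p+b≡1+d) (cong₂ _*_ (N₀-diag p) (N₁-top b))))
               (trans (pairs-emptyʳ 0 1 (suc d) (2 + d)) (N₀-subdiag (suc d))) ⟩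
    (2 + d) + (2 + d) C 2
  ≡⟨ pascal (suc d) ⟩
    (3 + d) C 2
  ∎
  where open ≡-Reasoning
main (suc k) d = begin
    N (2 + k) (4 + (k + d)) (suc d)
  ≡⟨ N-split (suc k) (3 + (k + d)) (suc d) ⟩
    P 0 (3 + (k + d)) + Σ₂ (2 + (k + d)) (λ p b → P (suc p) b)
  ≡⟨ cong (P 0 (3 + (k + d)) +_)
       (trans (Σ₂-last (suc (k + d)) (λ p b → P (suc p) b))
              (cong (_+ P (3 + (k + d)) 0) (Σ₂-last (k + d) (λ p b → P (suc p) (suc b))))) ⟩
    P 0 (3 + (k + d)) + ((Σ₂ (k + d) (λ p b → P (suc p) (2 + b)) + P (2 + (k + d)) 1) + P (3 + (k + d)) 0)
  ≡⟨ cong₂ (λ x y → x + ((y + P (2 + (k + d)) 1) + P (3 + (k + d)) 0)) max-first (Σ₂-vanish (k + d) middle) ⟩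
    1 + (P (2 + (k + d)) 1 + P (3 + (k + d)) 0)
  ≡⟨ cong₂ (λ x y → 1 + (x + y)) max-second-to-last (trans (pairs-emptyʳ (suc k) (2 + k) (suc d) (3 + (k + d))) (main k d)) ⟩
    2 + 2 * k + (3 + d) C 2
  ≡⟨ cong (_+ (3 + d) C 2) (sym (*-suc 2 k)) ⟩
    2 * suc k + (3 + d) C 2
  ∎
  where
  open ≡-Reasoning
  P : ℕ → ℕ → ℕ
  P = pairs (suc k) (2 + k) (suc d)
  k<1+k+d : ∀ {n} → n + k < n + suc (k + d)
  k<1+k+d {n} = +-monoʳ-< n (s≤s (m≤m+n k d))
  -- the maximum in front of a permutation with the extremal number of points
  max-first : P 0 (3 + (k + d)) ≡ 1
  max-first = trans (pairs-emptyˡ (suc k) (2 + k) (suc d) (3 + (k + d)))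
    (trans (cong (N (2 + k) (3 + (k + d))) (sym (1+k+d∸k k d))) (N-top (2 + k) (3 + (k + d)) (k<1+k+d {2})))
  -- an extremal permutation followed by the maximum and the entry 1
  max-second-to-last : P (2 + (k + d)) 1 ≡ 1
  max-second-to-last = trans (pairs-top (suc k) (2 + k) (suc d) (2 + (k + d)) 1 (trans (+-identityʳ _) (1+k+d∸k k d)))
    (cong (_* 1) (N-top (suc k) (2 + (k + d)) (k<1+k+d {1})))
  middle : ∀ p b → p + b ≡ k + d → P (suc p) (2 + b) ≡ 0
  middle p b p+b≡k+d = pairs-above (suc k) (2 + k) (suc d) (suc p) (2 + b)
    (s≤s (≤-trans (split-∸ k p+b≡k+d) (≤-reflexive (m+n∸m≡n k d))))

theorem27 : (n k : ℕ) → 3 ≤ n → 1 ≤ k →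
    coeffQ132 (n + k ∸ 1) k (n ∸ 2) ≡ 2 * (k ∸ 1) + n C 2
theorem27 zero                _       ()                     _
theorem27 (suc zero)          _       (s≤s ())               _
theorem27 (suc (suc zero))    _       (s≤s (s≤s ()))         _
theorem27 (suc (suc (suc d))) zero    _                      ()
theorem27 (suc (suc (suc d))) (suc k) _                      _ = begin
    coeffQ132 (3 + d + suc k ∸ 1) (suc k) (suc d)
  ≡⟨ coeffQ132≡N (2 + (d + suc k)) (suc k) (suc d) ⟩
    N (suc k) (2 + (d + suc k)) (suc d)
  ≡⟨ cong (λ x → N (suc k) (2 + x) (suc d)) (trans (+-suc d k) (cong suc (+-comm d k))) ⟩
    N (suc k) (3 + (k + d)) (suc d)
  ≡⟨ main k d ⟩
    2 * k + (3 + d) C 2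
  ∎
  where open ≡-Reasoning
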